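{- Let $\mathcal{B}$ be a finite undirected graph which is a tree. Then $\mathcal{B}$ has at most one pivot vertex.
   Context: A finite undirected graph $\mathcal{B}$ has a finite vertex set $\mathcal{V}$ and an edge set $\mathcal{E}$ consisting of $2$-element subsets of $\mathcal{V}$. If a group $G$ acts on $\mathcal{B}$ by graph automorphisms, a vertex $v$ is called a $G$-pivot vertex if for every $w\in\mathcal{V}$ with $\{v,w\}\in\mathcal{E}$, the orbit $\{gw\mid g\in G,\ gv=v\}$ of $w$ under the stabiliser of $v$ in $G$ has even cardinality. A pivot vertex of $\mathcal{B}$ is a $G$-pivot vertex for $G=\mathrm{Aut}(\mathcal{B})$, the automorphism group of the graph. -}

module Defs where

open import Data.Nat using (ℕ; suc; _≤_)
open import Data.Nat.Divisibility using (_∣_)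
open import Data.Bool using (Bool; true; false)
open import Data.Fin using (Fin)
open import Data.Fin.Subset using (Subset; _∈_; ∣_∣)
open import Data.Fin.Permutation using (Permutation′; _⟨$⟩ʳ_)
open import Data.List using (List; []; _∷_; length)
import Data.List
open import Data.Maybe using (just)
open import Data.Empty using (⊥)
open import Data.List.Relation.Unary.Unique.Propositional using (Unique)
open import Data.Product using (Σ; ∃; _×_; _,_)
open import Function.Bundles using (_⇔_)
open import Relation.Binary.PropositionalEquality using (_≡_)

-- A finite undirected (simple) graph on vertex set Fin n:
-- an adjacency relation that is symmetric and irreflexive, so that
-- edges are exactly the 2-element subsets {x , y} with adj x y ≡ true.
record Graph (n : ℕ) : Set where
  field
    adj     : Fin n → Fin n → Bool
    adj-sym : ∀ x y → adj x y ≡ adj y x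
    irrefl  : ∀ x → adj x x ≡ false
open Graph public

module _ {n : ℕ} (B : Graph n) where

  Adj : Fin n → Fin n → Set
  Adj x y = adj B x y ≡ true

  data Walk : Fin n → Fin n → Set where
    here : ∀ {x} → Walk x x
    step : ∀ {x y z} → Adj x y → Walk y z → Walk x z

  Connected : Set
  Connected = ∀ x y → Walk x y

  data Chain : List (Fin n) → Set where
    chain[] : Chain []
    chain1  : ∀ {x} → Chain (x ∷ [])
    chain∷  : ∀ {x y vs} → Adj x y → Chain (y ∷ vs) → Chain (x ∷ y ∷ vs)

  data IsCycle : List (Fin n) → Set where
    cycle : ∀ v vs last → 2 ≤ length vs →
            Unique (v ∷ vs) → Chain (v ∷ vs) →
            Data.List.last (v ∷ vs) ≡ just last → Adj last v → IsCycle (v ∷ vs)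

  Acyclic : Set
  Acyclic = ∀ vs → IsCycle vs → ⊥

  IsTree : Set
  IsTree = Connected × Acyclic

  IsAut : Permutation′ n → Set
  IsAut g = ∀ x y → adj B (g ⟨$⟩ʳ x) (g ⟨$⟩ʳ y) ≡ adj B x y

  InStabOrbit : Fin n → Fin n → Fin n → Set
  InStabOrbit v w u = Σ (Permutation′ n) λ g → IsAut g × (g ⟨$⟩ʳ v ≡ v) × (g ⟨$⟩ʳ w ≡ u)

  StabOrbitEven : Fin n → Fin n → Set
  StabOrbitEven v w = Σ (Subset n) λ S → (∀ u → (u ∈ S) ⇔ InStabOrbit v w u) × (2 ∣ ∣ S ∣)

  IsPivot : Fin n → Set
  IsPivot v = ∀ w → Adj v w → StabOrbitEven v w

module Submission where

-- For a vertex v and a neighbour x of v, the branch of v at x is the set of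
-- vertices reachable from x by a walk avoiding v.  In an acyclic graph the
-- branches at distinct neighbours of v are disjoint (a common vertex would
-- close a cycle through v).  Suppose v ≠ w are pivots, let x be the neighbour
-- of v towards w and y the neighbour of w towards v.  Evenness of the orbit
-- of x under Stab(v) yields g ∈ Stab(v) with g x ≠ x; such a g carries the
-- branch of v at x into another branch of v, which lies inside the branch of
-- w at y (branch transfer).  Symmetrically some h ∈ Stab(w) carries the
-- branch of w at y into the branch of v at x.  So the injective map h ∘ g
-- sends the finite set (branch of v at x) into itself, hence onto itself;
-- but w lies in this set and is never hit, since g u ≠ w = h w.

open import Defs
open import Data.Nat using (ℕ; zero; suc; _+_; _∸_; s≤s; z≤n)
open import Data.Nat.Properties using (n<1+n; +-suc; m+[n∸m]≡n)
open import Data.Nat.Divisibility using (_∣_; ∣1⇒≡1)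
open import Data.Fin using (Fin; toℕ; _≟_)
open import Data.Fin.Properties using (any?; pigeonhole)
open import Data.Fin.Subset using (Subset; ⁅_⁆; ∣_∣) renaming (_∈_ to _∈ₛ_)
open import Data.Fin.Subset.Properties using (_∈?_; ⊆-antisym; x∈⁅x⁆; x∈⁅y⁆⇒x≡y; ∣⁅x⁆∣≡1)
open import Data.Fin.Permutation using (Permutation′; _⟨$⟩ʳ_)
import Data.Fin.Permutation as Perm
open import Data.List using (List; []; _∷_; last)
open import Data.List.Relation.Unary.All using (All; []; _∷_)
import Data.List.Relation.Unary.All as All
open import Data.List.Relation.Unary.All.Properties using (¬Any⇒All¬)
open import Data.List.Relation.Unary.Any using (here; there)
open import Data.List.Relation.Unary.AllPairs using ([]; _∷_)
open import Data.List.Relation.Unary.Unique.Propositional using (Unique)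
open import Data.List.Membership.Propositional using (_∈_)
import Data.List.Membership.DecPropositional as DecMembership
open import Data.Maybe using (just)
open import Data.Empty using (⊥; ⊥-elim)
open import Data.Product using (∃; _×_; _,_)
open import Data.Sum using (_⊎_; inj₁; inj₂)
open import Function.Base using (_∘_)
open import Function.Bundles using (Injection; Equivalence)
open import Function.Definitions using (Injective)
open import Function.Properties.Inverse using (↔⇒↣)
open import Relation.Nullary using (yes; no; ¬?; _×-dec_)
open import Relation.Binary.PropositionalEquality

iterate : ∀ {A : Set} → (A → A) → ℕ → A → A
iterate f zero    a = a
iterate f (suc k) a = f (iterate f k a)

iterate-+ : ∀ {A : Set} (f : A → A) i j a →
            iterate f (i + j) a ≡ iterate f i (iterate f j a)
iterate-+ f zero    j a = refl
iterate-+ f (suc i) j a = cong f (iterate-+ f i j a)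

iterate-injective : ∀ {A : Set} {f : A → A} → Injective _≡_ _≡_ f →
                    ∀ i → Injective _≡_ _≡_ (iterate f i)
iterate-injective f-inj zero    eq = eq
iterate-injective f-inj (suc i) eq = iterate-injective f-inj i (f-inj eq)

-- Every point of an injective self-map of a finite set is periodic
-- (pigeonhole on the first n+1 iterates, then cancel the common prefix).
periodic : ∀ {n} {f : Fin n → Fin n} → Injective _≡_ _≡_ f →
           ∀ w → ∃ λ d → f (iterate f d w) ≡ w
periodic {n} {f} f-inj w
  with i , j , i<j , fⁱw≡fʲw ← pigeonhole (n<1+n n) (λ k → iterate f (toℕ k) w) =
  d , sym (iterate-injective f-inj (toℕ i) fⁱw≡fⁱfᵈ⁺¹w)
  where
    d = toℕ j ∸ suc (toℕ i)
    fⁱw≡fⁱfᵈ⁺¹w : iterate f (toℕ i) w ≡ iterate f (toℕ i) (iterate f (suc d) w)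
    fⁱw≡fⁱfᵈ⁺¹w = begin
      iterate f (toℕ i) w                        ≡⟨ fⁱw≡fʲw ⟩
      iterate f (toℕ j) w                        ≡⟨ cong (λ k → iterate f k w) (sym (m+[n∸m]≡n i<j)) ⟩
      iterate f (suc (toℕ i) + d) w              ≡⟨ cong (λ k → iterate f k w) (sym (+-suc (toℕ i) d)) ⟩
      iterate f (toℕ i + suc d) w                ≡⟨ iterate-+ f (toℕ i) (suc d) w ⟩
      iterate f (toℕ i) (iterate f (suc d) w)    ∎
      where open ≡-Reasoning

preimage-within : ∀ {n} {f : Fin n → Fin n} (P : Fin n → Set) →
                  Injective _≡_ _≡_ f → (∀ {u} → P u → P (f u)) →
                  ∀ {w} → P w → ∃ λ u → P u × f u ≡ w
preimage-within {f = f} P f-inj preserves {w} Pw with d , fᵈ⁺¹w≡w ← periodic f-inj w =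
  iterate f d w , iterates d , fᵈ⁺¹w≡w
  where
    iterates : ∀ k → P (iterate f k w)
    iterates zero    = Pw
    iterates (suc k) = preserves (iterates k)

-- A subset of even size containing x contains an element other than x
-- (otherwise it would be ⁅ x ⁆, of size 1).
even-subset-has-other : ∀ {n} {S : Subset n} {x} → x ∈ₛ S → 2 ∣ ∣ S ∣ →
                        ∃ λ u → u ∈ₛ S × u ≢ x
even-subset-has-other {S = S} {x} x∈S even with any? (λ u → u ∈? S ×-dec ¬? (u ≟ x))
... | yes other = other
... | no none   = ⊥-elim (2≢1 (∣1⇒≡1 (subst (2 ∣_) ∣S∣≡1 even)))
  where
    2≢1 : 2 ≢ 1
    2≢1 ()
    S⊆⁅x⁆ : ∀ {u} → u ∈ₛ S → u ∈ₛ ⁅ x ⁆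
    S⊆⁅x⁆ {u} u∈S with u ≟ x
    ... | yes refl = x∈⁅x⁆ x
    ... | no u≢x   = ⊥-elim (none (u , u∈S , u≢x))
    ⁅x⁆⊆S : ∀ {u} → u ∈ₛ ⁅ x ⁆ → u ∈ₛ S
    ⁅x⁆⊆S u∈⁅x⁆ rewrite x∈⁅y⁆⇒x≡y x u∈⁅x⁆ = x∈S
    ∣S∣≡1 : ∣ S ∣ ≡ 1
    ∣S∣≡1 = trans (cong ∣_∣ (⊆-antisym S⊆⁅x⁆ ⁅x⁆⊆S)) (∣⁅x⁆∣≡1 x)

perm-injective : ∀ {n} (g : Permutation′ n) → Injective _≡_ _≡_ (g ⟨$⟩ʳ_)
perm-injective g = Injection.injective (↔⇒↣ g)

orbit-contains-self : ∀ {n} (B : Graph n) v x → InStabOrbit B v x x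
orbit-contains-self B v x = Perm.id , (λ _ _ → refl) , refl , refl

-- A pivot's stabiliser moves each of its neighbours: the orbit of x contains
-- x itself and has even size, hence another point g x.
moved-neighbour : ∀ {n} (B : Graph n) {v x} → StabOrbitEven B v x →
                  ∃ λ g → IsAut B g × g ⟨$⟩ʳ v ≡ v × g ⟨$⟩ʳ x ≢ x
moved-neighbour B {v} {x} (S , S↔orbit , even)
  with u , u∈S , u≢x ← even-subset-has-other
                         (Equivalence.from (S↔orbit x) (orbit-contains-self B v x)) even
  with g , aut , gv≡v , gx≡u ← Equivalence.to (S↔orbit u) u∈S =
  g , aut , gv≡v , λ gx≡x → u≢x (trans (sym gx≡u) gx≡x)

module Branches {n : ℕ} (B : Graph n) where

  open DecMembership (_≟_ {n}) using () renaming (_∈?_ to _∈ₗ?_)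

  adj-flip : ∀ {a b} → Adj B a b → Adj B b a
  adj-flip {a} {b} e = trans (adj-sym B b a) e

  -- Walks in which every vertex (endpoints included) differs from v.
  -- The branch of v at a neighbour x is { u ∣ AvoidWalk v x u }.
  data AvoidWalk (v : Fin n) : Fin n → Fin n → Set where
    stop : ∀ {a} → a ≢ v → AvoidWalk v a a
    go   : ∀ {a b c} → a ≢ v → Adj B a b → AvoidWalk v b c → AvoidWalk v a c

  start-avoids : ∀ {v a b} → AvoidWalk v a b → a ≢ v
  start-avoids (stop a≢v)     = a≢v
  start-avoids (go a≢v _ _)   = a≢v

  end-avoids : ∀ {v a b} → AvoidWalk v a b → b ≢ v
  end-avoids (stop b≢v)   = b≢v
  end-avoids (go _ _ r)   = end-avoids r

  _++ᵃ_ : ∀ {v a b c} → AvoidWalk v a b → AvoidWalk v b c → AvoidWalk v a c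
  stop _     ++ᵃ q = q
  go p e r   ++ᵃ q = go p e (r ++ᵃ q)

  reverse : ∀ {v a b} → AvoidWalk v a b → AvoidWalk v b a
  reverse (stop p)     = stop p
  reverse (go p e r)   = reverse r ++ᵃ go (start-avoids r) (adj-flip e) (stop p)

  reavoid : ∀ {v w a b} → (∀ {z} → AvoidWalk v a z → z ≢ w) →
            AvoidWalk v a b → AvoidWalk w a b
  reavoid unreachable (stop p)   = stop (unreachable (stop p))
  reavoid unreachable (go p e r) =
    go (unreachable (stop p)) e (reavoid (unreachable ∘ go p e) r)

  -- Cutting a walk from c to b ≠ a at its last visit to a: either the walk
  -- never meets a, or it leaves a for the last time through a neighbour x.
  avoid-or-exit : ∀ {a c b} → Walk B c b → b ≢ a →
                  AvoidWalk a c b ⊎ ∃ λ x → Adj B a x × AvoidWalk a x b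
  avoid-or-exit here b≢a = inj₁ (stop b≢a)
  avoid-or-exit {a} {c} (step {y = d} e rest) b≢a with avoid-or-exit rest b≢a
  ... | inj₂ exit = inj₂ exit
  ... | inj₁ r with c ≟ a
  ...   | yes refl = inj₂ (d , e , r)
  ...   | no c≢a   = inj₁ (go c≢a e r)

  last-exit : ∀ {a b} → Walk B a b → b ≢ a → ∃ λ x → Adj B a x × AvoidWalk a x b
  last-exit w b≢a with avoid-or-exit w b≢a
  ... | inj₁ r    = ⊥-elim (start-avoids r refl)
  ... | inj₂ exit = exit

  record SimplePath (v a b : Fin n) : Set where
    field
      rest   : List (Fin n)
      chain  : Chain B (a ∷ rest)
      unique : Unique (a ∷ rest)
      avoids : All (_≢ v) (a ∷ rest)
      ends   : last (a ∷ rest) ≡ just b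

  suffix-from : ∀ {v a b} (K : List (Fin n)) → a ∈ K → Chain B K → Unique K →
                All (_≢ v) K → last K ≡ just b → SimplePath v a b
  suffix-from (_ ∷ K) (here refl) c u av l =
    record { rest = K ; chain = c ; unique = u ; avoids = av ; ends = l }
  suffix-from (_ ∷ k ∷ K) (there a∈K) (chain∷ _ c) (_ ∷ u) (_ ∷ av) l =
    suffix-from (k ∷ K) a∈K c u av l

  loop-erase : ∀ {v a b} → AvoidWalk v a b → SimplePath v a b
  loop-erase (stop p) =
    record { rest = [] ; chain = chain1 ; unique = [] ∷ [] ; avoids = p ∷ [] ; ends = refl }
  loop-erase {a = a} (go {b = b} p e r) with loop-erase r
  ... | record { rest = K ; chain = c ; unique = u ; avoids = av ; ends = l }
    with a ∈ₗ? (b ∷ K)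
  ...   | yes a∈bK = suffix-from (b ∷ K) a∈bK c u av l
  ...   | no a∉bK  = record { rest = b ∷ K ; chain = chain∷ e c
                            ; unique = ¬Any⇒All¬ (b ∷ K) a∉bK ∷ u
                            ; avoids = p ∷ av ; ends = l }

  module _ {g : Permutation′ n} (aut : IsAut B g) where

    aut-adj : ∀ {a b} → Adj B a b → Adj B (g ⟨$⟩ʳ a) (g ⟨$⟩ʳ b)
    aut-adj {a} {b} e = trans (aut a b) e

    aut-avoid : ∀ {v a b} → AvoidWalk v a b →
                AvoidWalk (g ⟨$⟩ʳ v) (g ⟨$⟩ʳ a) (g ⟨$⟩ʳ b)
    aut-avoid (stop p)   = stop (p ∘ perm-injective g)
    aut-avoid (go p e r) = go (p ∘ perm-injective g) (aut-adj e) (aut-avoid r)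

  module InAcyclic (acyclic : Acyclic B) where

    -- Branches of v at distinct neighbours are disjoint: a common vertex u
    -- gives a simple path x ⋯ u ⋯ x' avoiding v, closed to a cycle by v.
    branches-disjoint : ∀ {v x x' u} → Adj B v x → Adj B v x' → x ≢ x' →
                        AvoidWalk v x u → AvoidWalk v x' u → ⊥
    branches-disjoint {v} {x} {x'} vx vx' x≢x' r r' with loop-erase (r ++ᵃ reverse r')
    ... | record { rest = [] ; ends = refl } = x≢x' refl
    ... | record { rest = k ∷ K ; chain = c ; unique = u ; avoids = av ; ends = l } =
      acyclic (v ∷ x ∷ k ∷ K)
        (cycle v (x ∷ k ∷ K) x' (s≤s (s≤s z≤n))
               (All.map ≢-sym av ∷ u) (chain∷ vx c) l (adj-flip vx'))

    -- Branch transfer: if w is in the branch of v at x and v is in the branch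
    -- of w at y, then every other branch of v (at x' ≠ x) lies in the branch
    -- of w at y: go from y to v, step to x', and never meet w on the way.
    branch-transfer : ∀ {v w x x' y u} → v ≢ w → Adj B v x → Adj B v x' → x ≢ x' →
                      AvoidWalk v x w → AvoidWalk w y v →
                      AvoidWalk v x' u → AvoidWalk w y u
    branch-transfer {v} {w} {x' = x'} v≢w vx vx' x≢x' xw yv r =
      yv ++ᵃ go v≢w vx' (reavoid w-unreachable r)
      where
        w-unreachable : ∀ {z} → AvoidWalk v x' z → z ≢ w
        w-unreachable q refl = branches-disjoint vx vx' x≢x' xw q

    move-across : ∀ {v w x y u} (g : Permutation′ n) → v ≢ w →
                  Adj B v x → AvoidWalk v x w → AvoidWalk w y v →
                  IsAut B g → g ⟨$⟩ʳ v ≡ v → g ⟨$⟩ʳ x ≢ x →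
                  AvoidWalk v x u → AvoidWalk w y (g ⟨$⟩ʳ u)
    move-across {v} {x = x} {u = u} g v≢w vx xw yv aut gv≡v gx≢x r =
      branch-transfer v≢w vx v-gx (gx≢x ∘ sym) xw yv g-r
      where
        v-gx : Adj B v (g ⟨$⟩ʳ x)
        v-gx = subst (λ z → Adj B z (g ⟨$⟩ʳ x)) gv≡v (aut-adj {g = g} aut vx)
        g-r : AvoidWalk v (g ⟨$⟩ʳ x) (g ⟨$⟩ʳ u)
        g-r = subst (λ z → AvoidWalk z (g ⟨$⟩ʳ x) (g ⟨$⟩ʳ u)) gv≡v (aut-avoid {g = g} aut r)

    -- If g ∈ Stab(v) moves x and h ∈ Stab(w) moves y, then h ∘ g maps the
    -- branch of v at x injectively into itself, so it hits w from inside
    -- that branch; but g u lies in the branch of w at y, so h (g u) ≠ h w.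
    swapped-branches : ∀ {v w x y} (g h : Permutation′ n) → v ≢ w →
                       Adj B v x → Adj B w y → AvoidWalk v x w → AvoidWalk w y v →
                       IsAut B g → g ⟨$⟩ʳ v ≡ v → g ⟨$⟩ʳ x ≢ x →
                       IsAut B h → h ⟨$⟩ʳ w ≡ w → h ⟨$⟩ʳ y ≢ y → ⊥
    swapped-branches {v} {w} {x} {y} g h v≢w vx wy xw yv aut-g gv≡v gx≢x aut-h hw≡w hy≢y
      = w-not-hit (preimage-within (AvoidWalk v x)
                    (perm-injective g ∘ perm-injective h) (back ∘ across) xw)
      where
        across : ∀ {u} → AvoidWalk v x u → AvoidWalk w y (g ⟨$⟩ʳ u)
        across = move-across g v≢w vx xw yv aut-g gv≡v gx≢x
        back : ∀ {u} → AvoidWalk w y u → AvoidWalk v x (h ⟨$⟩ʳ u)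
        back = move-across h (v≢w ∘ sym) wy yv xw aut-h hw≡w hy≢y
        w-not-hit : (∃ λ u → AvoidWalk v x u × h ⟨$⟩ʳ (g ⟨$⟩ʳ u) ≡ w) → ⊥
        w-not-hit (u , xu , hgu≡w) =
          end-avoids (across xu) (perm-injective h (trans hgu≡w (sym hw≡w)))

    distinct-pivots : Connected B → ∀ {v w} → v ≢ w →
                      IsPivot B v → IsPivot B w → ⊥
    distinct-pivots connected {v} {w} v≢w v-pivot w-pivot
      with x , vx , xw ← last-exit (connected v w) (v≢w ∘ sym)
         | y , wy , yv ← last-exit (connected w v) v≢w
      with g , aut-g , gv≡v , gx≢x ← moved-neighbour B (v-pivot x vx)
         | h , aut-h , hw≡w , hy≢y ← moved-neighbour B (w-pivot y wy) =
      swapped-branches g h v≢w vx wy xw yv aut-g gv≡v gx≢x aut-h hw≡w hy≢y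

proposition3p1 : ∀ (n : ℕ) (B : Graph n) → IsTree B →
    ∀ (v w : Fin n) → IsPivot B v → IsPivot B w → v ≡ w
proposition3p1 n B (connected , acyclic) v w v-pivot w-pivot with v ≟ w
... | yes v≡w = v≡w
... | no v≢w  = ⊥-elim (distinct-pivots connected v≢w v-pivot w-pivot)
  where open Branches.InAcyclic B acyclic
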